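{- Let $d \ge 2$ be an integer, and define polynomials $r_n, s_n \in \mathbb{Z}[b]$ by $r_0 = s_0 = 1$ and, for $n \ge 0$, \[ r_{n+1} = (b+1)\,d\, r_n s_n^{d-1}, \qquad s_{n+1} = r_n^d + (d-1) s_n^d. \] For $m \ge 1$ set $\sigma_m = (b+1)d\, s_{m-1}^d$ and $\tau_m = s_m - \sigma_m$. Let $m \ge 2$ and let $i,j$ be the unique integers with $m = di + j$, $j \in \{2, \dots, d+1\}$. If $m \equiv 2 \pmod d$, then \[ \deg \sigma_m = \frac{d^{m+d-1} - d^{d+1}}{d^d - 1} + 1, \qquad \deg \tau_m = \frac{d^{m+d-1} - d}{d^d - 1} = \deg s_m. \] Otherwise, \[ \deg \sigma_m = \deg \tau_m = \frac{d^{m+d-1} - d^{j-1}}{d^d - 1} + 1. \] In particular, \[ \lim_{m \to \infty} \frac{\deg \sigma_m}{d^{m-1}} = \lim_{m \to \infty} \frac{\deg \tau_m}{d^{m-1}} = \frac{d^d}{d^d - 1}. \]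
   Context: Here $\deg$ denotes the degree in the variable $b$. -}

module Defs where

open import Data.Nat as ℕ using (ℕ; zero; suc; _∸_; _^_)
open import Data.Nat.DivMod as DM using ()
open import Data.Integer as ℤ using (ℤ; +_; 0ℤ; 1ℤ)
open import Data.Rational as ℚ using (ℚ; 0ℚ)
open import Data.List using (List; []; _∷_; length)
open import Data.Product using (_×_; _,_; proj₁; proj₂; ∃-syntax)
open import Relation.Nullary using (yes; no)

-- Polynomials in ℤ[b], as coefficient lists (lowest degree first).
Poly : Set
Poly = List ℤ

infixl 6 _⊕_ _⊖_
infixl 7 _⊗_

_⊕_ : Poly → Poly → Poly
[] ⊕ q = q
(a ∷ p) ⊕ [] = a ∷ p
(a ∷ p) ⊕ (c ∷ q) = (a ℤ.+ c) ∷ (p ⊕ q)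

scale : ℤ → Poly → Poly
scale a [] = []
scale a (c ∷ q) = (a ℤ.* c) ∷ scale a q

neg : Poly → Poly
neg = scale (ℤ.- 1ℤ)

_⊖_ : Poly → Poly → Poly
p ⊖ q = p ⊕ neg q

_⊗_ : Poly → Poly → Poly
[] ⊗ q = []
(a ∷ p) ⊗ q = scale a q ⊕ (0ℤ ∷ (p ⊗ q))

const : ℤ → Poly
const a = a ∷ []

varB : Poly
varB = 0ℤ ∷ 1ℤ ∷ []

_^ᵖ_ : Poly → ℕ → Poly
p ^ᵖ zero = const 1ℤ
p ^ᵖ suc n = p ⊗ (p ^ᵖ n)

normalize : Poly → Poly
normalize [] = []
normalize (a ∷ p) with normalize p
... | c ∷ q = a ∷ c ∷ q
... | [] with a ℤ.≟ 0ℤ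
...   | yes _ = []
...   | no _ = a ∷ []

-- degree in b (the zero polynomial gets degree 0 by convention)
deg : Poly → ℕ
deg p = length (normalize p) ∸ 1

rs : ℕ → ℕ → Poly × Poly
rs d zero = const 1ℤ , const 1ℤ
rs d (suc n) =
  let r = proj₁ (rs d n) ; s = proj₂ (rs d n) in
  ((varB ⊕ const 1ℤ) ⊗ const (+ d) ⊗ r ⊗ (s ^ᵖ (d ∸ 1))) ,
  ((r ^ᵖ d) ⊕ const (+ (d ∸ 1)) ⊗ (s ^ᵖ d))

r : ℕ → ℕ → Poly
r d n = proj₁ (rs d n)

s : ℕ → ℕ → Poly
s d n = proj₂ (rs d n)

-- σ_m = (b+1) d s_{m-1}^d  (meaningful for m ≥ 1)
σ : ℕ → ℕ → Poly
σ d m = (varB ⊕ const 1ℤ) ⊗ const (+ d) ⊗ (s d (m ∸ 1) ^ᵖ d)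

τ : ℕ → ℕ → Poly
τ d m = s d m ⊖ σ d m

-- natural-number division, total (dividing by 0 gives 0; never used with 0)
_divℕ_ : ℕ → ℕ → ℕ
a divℕ zero = 0
a divℕ suc k = a DM./ suc k

-- rational a / b, total (dividing by 0 gives 0; never used with 0)
_÷ℕ_ : ℕ → ℕ → ℚ
a ÷ℕ zero = 0ℚ
a ÷ℕ suc k = (+ a) ℚ./ suc k

ConvergesTo : (ℕ → ℚ) → ℚ → Set
ConvergesTo a L =
  ∀ (ε : ℚ) → 0ℚ ℚ.< ε → ∃[ N ] (∀ m → N ℕ.≤ m → ℚ.∣ a m ℚ.- L ∣ ℚ.< ε)

-- Every polynomial that occurs has a positive leading coefficient, so degrees add under
-- products and take maxima under sums: with a = deg r and c = deg s,
-- a(n+1) = 1 + a(n) + (d-1)c(n), c(n+1) = d max(a(n), c(n)) and deg σ(n+1) = 1 + d c(n).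
-- This recursion is solved in closed form by induction on n, tracking the residue of n
-- modulo d. In particular deg s(m) and deg σ(m) never coincide, so deg τ(m) is the larger
-- of the two, and both deg σ(m) and deg τ(m) stay within a bounded distance of
-- d^d d^(m-1) / (d^d - 1), which gives the limits.

module Submission where

open import Defs
open import Data.Nat using (ℕ; _+_; _*_; _∸_; _^_; _≤_)
open import Relation.Binary.PropositionalEquality using (_≡_)
open import Data.Nat.Divisibility using (_∣_)
open import Data.Product using (_×_)
open import Relation.Nullary using (¬_)

open import Data.Nat as ℕ using (zero; suc; _<_; _⊔_; ∣_-_∣; z≤n; s≤s)
import Data.Nat.Properties as ℕP
open import Data.Nat.Coprimality using (Coprime)
open import Data.Nat.Divisibility using (m∣m*n; ∣m+n∣m⇒∣n; >⇒∤)
import Data.Nat.DivMod as DM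
open import Data.Nat.Tactic.RingSolver using (solve-∀)
open import Data.Integer as ℤ using (ℤ; +_; 0ℤ; 1ℤ; +[1+_]; -[1+_])
import Data.Integer.Properties as ℤP
open import Data.Rational as ℚ using (mkℚ; toℚᵘ; fromℚᵘ)
import Data.Rational.Properties as ℚP
open import Data.Rational.Unnormalised as ℚᵘ using (ℚᵘ; mkℚᵘ; *<*)
import Data.Rational.Unnormalised.Properties as ℚᵘP
open import Data.List using ([]; _∷_; length)
open import Data.Product using (_,_; proj₁; proj₂; ∃-syntax)
open import Data.Sum using (inj₁; inj₂)
open import Data.Empty using (⊥-elim)
open import Relation.Nullary using (yes; no)
open import Relation.Binary.PropositionalEquality
open import Relation.Binary.Definitions using (tri<; tri≈; tri>)

coef : Poly → ℕ → ℤ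
coef []      k       = 0ℤ
coef (a ∷ p) zero    = a
coef (a ∷ p) (suc k) = coef p k

coef-⊕ : ∀ p q k → coef (p ⊕ q) k ≡ coef p k ℤ.+ coef q k
coef-⊕ []      q       k       = sym (ℤP.+-identityˡ (coef q k))
coef-⊕ (a ∷ p) []      k       = sym (ℤP.+-identityʳ (coef (a ∷ p) k))
coef-⊕ (a ∷ p) (c ∷ q) zero    = refl
coef-⊕ (a ∷ p) (c ∷ q) (suc k) = coef-⊕ p q k

coef-scale : ∀ a p k → coef (scale a p) k ≡ a ℤ.* coef p k
coef-scale a []      k       = sym (ℤP.*-zeroʳ a)
coef-scale a (c ∷ p) zero    = refl
coef-scale a (c ∷ p) (suc k) = coef-scale a p k

coef-⊖ : ∀ p q k → coef (p ⊖ q) k ≡ coef p k ℤ.- coef q k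
coef-⊖ p q k = trans (coef-⊕ p (neg q) k)
  (cong (λ w → coef p k ℤ.+ w) (trans (coef-scale _ q k) (ℤP.-1*i≡-i (coef q k))))

VanishesFrom : Poly → ℕ → Set
VanishesFrom p n = ∀ k → n ≤ k → coef p k ≡ 0ℤ

vanishesFrom-tail : ∀ {a p n} → VanishesFrom (a ∷ p) (suc n) → VanishesFrom p n
vanishesFrom-tail v k n≤k = v (suc k) (s≤s n≤k)

vanishesFrom-mono : ∀ p {n m} → n ≤ m → VanishesFrom p n → VanishesFrom p m
vanishesFrom-mono p n≤m v k m≤k = v k (ℕP.≤-trans n≤m m≤k)

zero-⊗ : ∀ p q → VanishesFrom p 0 → VanishesFrom (p ⊗ q) 0
zero-⊗ []      q vp k       _ = refl
zero-⊗ (a ∷ p) q vp k       _ = begin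
  coef (scale a q ⊕ (0ℤ ∷ (p ⊗ q))) k        ≡⟨ coef-⊕ (scale a q) _ k ⟩
  coef (scale a q) k ℤ.+ coef (0ℤ ∷ p ⊗ q) k ≡⟨ cong₂ ℤ._+_ (coef-scale a q k) (shifted k) ⟩
  a ℤ.* coef q k ℤ.+ 0ℤ                      ≡⟨ cong (λ x → x ℤ.* coef q k ℤ.+ 0ℤ) (vp 0 z≤n) ⟩
  0ℤ                                         ∎
  where
  open ≡-Reasoning
  shifted : ∀ k → coef (0ℤ ∷ p ⊗ q) k ≡ 0ℤ
  shifted zero    = refl
  shifted (suc k) = zero-⊗ p q (λ j _ → vp (suc j) z≤n) k z≤n

⊗-vanishesFrom : ∀ p q {n m} → VanishesFrom p (suc n) → VanishesFrom q (suc m) →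
                 VanishesFrom (p ⊗ q) (suc (n + m))
⊗-vanishesFrom []      q         vp vq k _ = refl
⊗-vanishesFrom (a ∷ p) q {n} {m} vp vq k n+m<k = begin
  coef (scale a q ⊕ (0ℤ ∷ (p ⊗ q))) k        ≡⟨ coef-⊕ (scale a q) _ k ⟩
  coef (scale a q) k ℤ.+ coef (0ℤ ∷ p ⊗ q) k ≡⟨ cong₂ ℤ._+_ (coef-scale a q k) (shifted k n+m<k) ⟩
  a ℤ.* coef q k ℤ.+ 0ℤ                      ≡⟨ cong (λ x → a ℤ.* x ℤ.+ 0ℤ) q-vanishes ⟩
  a ℤ.* 0ℤ ℤ.+ 0ℤ                            ≡⟨ cong (ℤ._+ 0ℤ) (ℤP.*-zeroʳ a) ⟩
  0ℤ                                         ∎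
  where
  open ≡-Reasoning
  q-vanishes : coef q k ≡ 0ℤ
  q-vanishes = vq k (ℕP.≤-trans (s≤s (ℕP.m≤n+m m n)) n+m<k)
  below : ∀ n → VanishesFrom p n → VanishesFrom (p ⊗ q) (n + m)
  below zero    vp′ k _ = zero-⊗ p q vp′ k z≤n
  below (suc n) vp′     = ⊗-vanishesFrom p q vp′ vq
  shifted : ∀ k → suc (n + m) ≤ k → coef (0ℤ ∷ p ⊗ q) k ≡ 0ℤ
  shifted (suc k) (s≤s n+m≤k) = below n (vanishesFrom-tail vp) k n+m≤k

coef-⊗-leading : ∀ p q {n m} → VanishesFrom p (suc n) → VanishesFrom q (suc m) →
             coef (p ⊗ q) (n + m) ≡ coef p n ℤ.* coef q m
coef-⊗-leading []      q               vp vq = refl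
coef-⊗-leading (a ∷ p) q {zero}  {m}   vp vq = begin
  coef (scale a q ⊕ (0ℤ ∷ p ⊗ q)) m          ≡⟨ coef-⊕ (scale a q) _ m ⟩
  coef (scale a q) m ℤ.+ coef (0ℤ ∷ p ⊗ q) m ≡⟨ cong₂ ℤ._+_ (coef-scale a q m) (shifted m) ⟩
  a ℤ.* coef q m ℤ.+ 0ℤ                      ≡⟨ ℤP.+-identityʳ _ ⟩
  a ℤ.* coef q m                             ∎
  where
  open ≡-Reasoning
  shifted : ∀ k → coef (0ℤ ∷ p ⊗ q) k ≡ 0ℤ
  shifted zero    = refl
  shifted (suc k) = zero-⊗ p q (vanishesFrom-tail vp) k z≤n
coef-⊗-leading (a ∷ p) q {suc n} {m} vp vq = begin
  coef (scale a q ⊕ (0ℤ ∷ p ⊗ q)) (suc n + m)              ≡⟨ coef-⊕ (scale a q) _ (suc n + m) ⟩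
  coef (scale a q) (suc n + m) ℤ.+ coef (p ⊗ q) (n + m)    ≡⟨ cong₂ ℤ._+_ q-vanishes
                                                                 (coef-⊗-leading p q (vanishesFrom-tail vp) vq) ⟩
  0ℤ ℤ.+ coef p n ℤ.* coef q m                             ≡⟨ ℤP.+-identityˡ _ ⟩
  coef p n ℤ.* coef q m                                    ∎
  where
  open ≡-Reasoning
  q-vanishes : coef (scale a q) (suc n + m) ≡ 0ℤ
  q-vanishes = trans (coef-scale a q (suc n + m))
    (trans (cong (a ℤ.*_) (vq (suc n + m) (s≤s (ℕP.m≤n+m m n)))) (ℤP.*-zeroʳ a))

-- Positive leading coefficients cannot cancel in a sum.
record HasDegree⁺ (p : Poly) (n : ℕ) : Set where
  constructor hasDegree⁺
  field
    vanishes : VanishesFrom p (suc n)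
    leading  : ℕ
    coef≡    : coef p n ≡ +[1+ leading ]

⊗-hasDegree⁺ : ∀ {p q n m} → HasDegree⁺ p n → HasDegree⁺ q m → HasDegree⁺ (p ⊗ q) (n + m)
⊗-hasDegree⁺ {p} {q} (hasDegree⁺ vp _ lp) (hasDegree⁺ vq _ lq) =
  hasDegree⁺ (⊗-vanishesFrom p q vp vq) _ (trans (coef-⊗-leading p q vp vq) (cong₂ ℤ._*_ lp lq))

const-hasDegree⁺ : ∀ x → HasDegree⁺ (const +[1+ x ]) 0
const-hasDegree⁺ x = hasDegree⁺ (λ { (suc k) _ → refl }) x refl

^ᵖ-hasDegree⁺ : ∀ {p n} → HasDegree⁺ p n → ∀ k → HasDegree⁺ (p ^ᵖ k) (k * n)
^ᵖ-hasDegree⁺ hp zero    = const-hasDegree⁺ 0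
^ᵖ-hasDegree⁺ hp (suc k) = ⊗-hasDegree⁺ hp (^ᵖ-hasDegree⁺ hp k)

⊕-vanishesFrom : ∀ p q {k} → VanishesFrom p k → VanishesFrom q k → VanishesFrom (p ⊕ q) k
⊕-vanishesFrom p q vp vq j k≤j = trans (coef-⊕ p q j) (cong₂ ℤ._+_ (vp j k≤j) (vq j k≤j))

⊕-hasDegree⁺ : ∀ {p q n m} → HasDegree⁺ p n → HasDegree⁺ q m → HasDegree⁺ (p ⊕ q) (n ⊔ m)
⊕-hasDegree⁺ {p} {q} {n} {m} (hasDegree⁺ vp x lp) (hasDegree⁺ vq y lq) with ℕP.<-cmp n m
... | tri< n<m _ _ rewrite ℕP.m≤n⇒m⊔n≡n (ℕP.<⇒≤ n<m) =
  hasDegree⁺ (⊕-vanishesFrom p q (vanishesFrom-mono p (ℕP.<⇒≤ (s≤s n<m)) vp) vq)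
    y (trans (coef-⊕ p q m) (cong₂ ℤ._+_ (vp m n<m) lq))
... | tri≈ _ refl _ rewrite ℕP.⊔-idem n =
  hasDegree⁺ (⊕-vanishesFrom p q vp vq) (x + suc y) (trans (coef-⊕ p q n) (cong₂ ℤ._+_ lp lq))
... | tri> _ _ m<n rewrite ℕP.m≥n⇒m⊔n≡m (ℕP.<⇒≤ m<n) =
  hasDegree⁺ (⊕-vanishesFrom p q vp (vanishesFrom-mono q (ℕP.<⇒≤ (s≤s m<n)) vq))
    x (trans (coef-⊕ p q n) (trans (cong₂ ℤ._+_ lp (vq n m<n)) (ℤP.+-identityʳ _)))

normalize-vanishing : ∀ p → VanishesFrom p 0 → normalize p ≡ []
normalize-vanishing []      v = refl
normalize-vanishing (a ∷ p) v with normalize p | normalize-vanishing p (λ k _ → v (suc k) z≤n)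
... | [] | refl with a ℤ.≟ 0ℤ
...   | yes _   = refl
...   | no a≢0  = ⊥-elim (a≢0 (v 0 z≤n))

length-normalize : ∀ p n → VanishesFrom p (suc n) → coef p n ≢ 0ℤ → length (normalize p) ≡ suc n
length-normalize []      n       v c≢0 = ⊥-elim (c≢0 refl)
length-normalize (a ∷ p) zero    v c≢0 with normalize p | normalize-vanishing p (vanishesFrom-tail v)
... | [] | refl with a ℤ.≟ 0ℤ
...   | yes a≡0 = ⊥-elim (c≢0 a≡0)
...   | no _    = refl
length-normalize (a ∷ p) (suc n) v c≢0 with normalize p | length-normalize p n (vanishesFrom-tail v) c≢0
... | _ ∷ _ | eq = cong suc eq

deg-exact : ∀ p n → VanishesFrom p (suc n) → coef p n ≢ 0ℤ → deg p ≡ n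
deg-exact p n v c≢0 = cong (ℕ._∸ 1) (length-normalize p n v c≢0)

deg-hasDegree⁺ : ∀ {p n} → HasDegree⁺ p n → deg p ≡ n
deg-hasDegree⁺ {p} {n} (hasDegree⁺ v x c≡) = deg-exact p n v leading≢0
  where
  leading≢0 : coef p n ≢ 0ℤ
  leading≢0 c≡0 with trans (sym c≡) c≡0
  ... | ()

deg-⊖ˡ : ∀ {p q n m} → HasDegree⁺ p n → HasDegree⁺ q m → m < n → deg (p ⊖ q) ≡ n
deg-⊖ˡ {p} {q} {n} (hasDegree⁺ vp x lp) (hasDegree⁺ vq _ _) m<n = deg-exact (p ⊖ q) n vanishes leading≢0
  where
  vanishes : VanishesFrom (p ⊖ q) (suc n)
  vanishes k n<k = trans (coef-⊖ p q k) (cong₂ ℤ._-_ (vp k n<k) (vq k (ℕP.<-trans m<n n<k)))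
  leading : coef (p ⊖ q) n ≡ +[1+ x ]
  leading = trans (coef-⊖ p q n) (trans (cong₂ ℤ._-_ lp (vq n m<n)) (ℤP.+-identityʳ _))
  leading≢0 : coef (p ⊖ q) n ≢ 0ℤ
  leading≢0 c≡0 with trans (sym leading) c≡0
  ... | ()

deg-⊖ʳ : ∀ {p q n m} → HasDegree⁺ p n → HasDegree⁺ q m → n < m → deg (p ⊖ q) ≡ m
deg-⊖ʳ {p} {q} {m = m} (hasDegree⁺ vp _ _) (hasDegree⁺ vq y lq) n<m = deg-exact (p ⊖ q) m vanishes leading≢0
  where
  vanishes : VanishesFrom (p ⊖ q) (suc m)
  vanishes k m<k = trans (coef-⊖ p q k) (cong₂ ℤ._-_ (vp k (ℕP.<-trans n<m m<k)) (vq k m<k))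
  leading : coef (p ⊖ q) m ≡ -[1+ y ]
  leading = trans (coef-⊖ p q m) (cong₂ ℤ._-_ (vp m n<m) lq)
  leading≢0 : coef (p ⊖ q) m ≢ 0ℤ
  leading≢0 c≡0 with trans (sym leading) c≡0
  ... | ()

∣⊖∣≡∣-∣ : ∀ m n → ℤ.∣ m ℤ.⊖ n ∣ ≡ ∣ m - n ∣
∣⊖∣≡∣-∣ m n with ℕP.≤-total m n
... | inj₁ m≤n = trans (ℤP.∣⊖∣-≤ m≤n) (sym (ℕP.m≤n⇒∣m-n∣≡n∸m m≤n))
... | inj₂ n≤m = trans (ℤP.∣m⊖n∣≡∣n⊖m∣ m n)
  (trans (ℤP.∣⊖∣-≤ n≤m) (trans (sym (ℕP.m≤n⇒∣m-n∣≡n∸m n≤m)) (ℕP.∣-∣-comm n m)))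

∣÷ℕ-÷ℕ∣< : ∀ x Y L D {p q} .{c : Coprime (suc p) (suc q)} → ∣ x * suc D - L * suc Y ∣ * suc q < suc p * (suc Y * suc D) →
           ℚ.∣ x ÷ℕ suc Y ℚ.- L ÷ℕ suc D ∣ ℚ.< mkℚ +[1+ p ] q c
∣÷ℕ-÷ℕ∣< x Y L D {p} {q} lt = ℚP.toℚᵘ-cancel-< (ℚᵘP.<-respˡ-≃ (ℚᵘP.≃-sym toℚᵘ-distance) (*<* cross))
  where
  X Lᵘ : ℚᵘ
  X  = mkℚᵘ (+ x) Y
  Lᵘ = mkℚᵘ (+ L) D
  toℚᵘ-distance : toℚᵘ (ℚ.∣ fromℚᵘ X ℚ.- fromℚᵘ Lᵘ ∣) ℚᵘ.≃ ℚᵘ.∣ X ℚᵘ.- Lᵘ ∣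
  toℚᵘ-distance = ℚᵘP.≃-trans (ℚP.toℚᵘ-homo-∣-∣ (fromℚᵘ X ℚ.- fromℚᵘ Lᵘ)) (ℚᵘP.∣-∣-cong
    (ℚᵘP.≃-trans (ℚP.toℚᵘ-homo-+ (fromℚᵘ X) (ℚ.- fromℚᵘ Lᵘ)) (ℚᵘP.+-cong (ℚP.toℚᵘ-fromℚᵘ X)
      (ℚᵘP.≃-trans (ℚP.toℚᵘ-homo‿- (fromℚᵘ Lᵘ)) (ℚᵘP.-‿cong (ℚP.toℚᵘ-fromℚᵘ Lᵘ))))))
  numerator≡ : (+ x) ℤ.* (+ suc D) ℤ.+ (ℤ.- (+ L)) ℤ.* (+ suc Y) ≡ (x * suc D) ℤ.⊖ (L * suc Y)
  numerator≡ = trans (cong₂ ℤ._+_ (sym (ℤP.pos-* x (suc D)))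
      (trans (sym (ℤP.neg-distribˡ-* (+ L) (+ suc Y))) (cong ℤ.-_ (sym (ℤP.pos-* L (suc Y))))))
    (ℤP.m-n≡m⊖n (x * suc D) (L * suc Y))
  cross : + ℤ.∣ (+ x) ℤ.* (+ suc D) ℤ.+ (ℤ.- (+ L)) ℤ.* (+ suc Y) ∣ ℤ.* + suc q
          ℤ.< +[1+ p ] ℤ.* + (suc Y * suc D)
  cross rewrite numerator≡ | ∣⊖∣≡∣-∣ (x * suc D) (L * suc Y) =
    subst₂ ℤ._<_ (ℤP.pos-* ∣ x * suc D - L * suc Y ∣ (suc q)) (ℤP.pos-* (suc p) (suc Y * suc D)) (ℤ.+<+ lt)

Eventually : (ℕ → Set) → Set
Eventually P = ∃[ N ] ∀ m → N ≤ m → P m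

Unbounded : (ℕ → ℕ) → Set
Unbounded g = ∀ B → Eventually (λ m → B < g m)

ratio-converges : ∀ (f g : ℕ → ℕ) L D K → 0 < D → Unbounded g →
                  Eventually (λ m → ∣ f m * D - L * g m ∣ ≤ K) →
                  ConvergesTo (λ m → f m ÷ℕ g m) (L ÷ℕ D)
ratio-converges f g L (suc D) K _ _ _ (mkℚ (+ 0) _ _) (ℚ.*<* (ℤ.+<+ ()))
ratio-converges f g L (suc D) K _ _ _ (mkℚ -[1+ _ ] _ _) (ℚ.*<* ())
ratio-converges f g L (suc D) K _ unbounded (N₂ , close) (mkℚ +[1+ p ] q _) _ with unbounded (K * suc q)
... | N₁ , large = N₁ ⊔ N₂ , λ m N≤m →
  estimate (g m) (large m (ℕP.m⊔n≤o⇒m≤o N₁ N₂ N≤m)) (close m (ℕP.m⊔n≤o⇒n≤o N₁ N₂ N≤m))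
  where
  estimate : ∀ {m} Y → K * suc q < Y → ∣ f m * suc D - L * Y ∣ ≤ K →
             ℚ.∣ f m ÷ℕ Y ℚ.- L ÷ℕ suc D ∣ ℚ.< _
  estimate {m} (suc Y) Kq<Y dist≤K = ∣÷ℕ-÷ℕ∣< (f m) Y L D (begin-strict
    ∣ f m * suc D - L * suc Y ∣ * suc q ≤⟨ ℕP.*-monoˡ-≤ (suc q) dist≤K ⟩
    K * suc q                           <⟨ Kq<Y ⟩
    suc Y                               ≤⟨ ℕP.m≤m*n (suc Y) (suc D) ⟩
    suc Y * suc D                       ≤⟨ ℕP.m≤n*m (suc Y * suc D) (suc p) ⟩
    suc p * (suc Y * suc D)             ∎)
    where open ℕP.≤-Reasoning

n<m^n : ∀ {m} → 1 < m → ∀ n → n < m ^ n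
n<m^n 1<m zero    = s≤s z≤n
n<m^n 1<m (suc n) = ℕP.≤-<-trans (n<m^n 1<m n) (ℕP.^-monoʳ-< _ 1<m (ℕP.n<1+n n))

^-pred-unbounded : ∀ {m} → 1 < m → Unbounded (λ n → m ^ (n ∸ 1))
^-pred-unbounded 1<m B = suc B , λ n B<n → ℕP.≤-<-trans (ℕP.∸-monoˡ-≤ 1 B<n) (n<m^n 1<m (n ∸ 1))

∣-∣≤ : ∀ x z t u → x + t ≡ z + u → ∣ x - z ∣ ≤ t + u
∣-∣≤ x z t u x+t≡z+u = begin
  ∣ x - z ∣                     ≤⟨ ℕP.∣-∣-triangle x (x + t) z ⟩
  ∣ x - x + t ∣ + ∣ x + t - z ∣ ≡⟨ cong₂ _+_ (ℕP.∣m-m+n∣≡n x t) (cong (λ y → ∣ y - z ∣) x+t≡z+u) ⟩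
  t + ∣ z + u - z ∣             ≡⟨ cong (λ y → t + y) (trans (ℕP.∣-∣-comm (z + u) z) (ℕP.∣m-m+n∣≡n z u)) ⟩
  t + u                         ∎
  where open ℕP.≤-Reasoning

divℕ-exact : ∀ {D x t E} → 0 < D → D * x + t ≡ E → (E ∸ t) divℕ D ≡ x
divℕ-exact {suc D} {x} {t} _ refl = begin
  (suc D * x + t ∸ t) DM./ suc D ≡⟨ cong (DM._/ suc D) (ℕP.m+n∸n≡m (suc D * x) t) ⟩
  (suc D * x) DM./ suc D         ≡⟨ cong (DM._/ suc D) (ℕP.*-comm (suc D) x) ⟩
  (x * suc D) DM./ suc D         ≡⟨ DM.m*n/n≡m x (suc D) ⟩
  x                              ∎
  where open ≡-Reasoning

b+1-hasDegree⁺ : HasDegree⁺ (varB ⊕ const 1ℤ) 1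
b+1-hasDegree⁺ = hasDegree⁺ (λ { (suc zero) (s≤s ()) ; (suc (suc k)) _ → refl }) 0 refl

-- Writing d = 2 + e′ makes d ∸ 1 in the definitions of r and s compute.
module Recurrence (e′ : ℕ) where

  e d : ℕ
  e = suc e′
  d = suc e

  degr degs : ℕ → ℕ
  degr zero    = 0
  degr (suc n) = suc (degr n + e * degs n)
  degs zero    = 0
  degs (suc n) = d * degr n ⊔ d * degs n

  rs-hasDegree⁺ : ∀ n → HasDegree⁺ (r d n) (degr n) × HasDegree⁺ (s d n) (degs n)
  rs-hasDegree⁺ zero    = const-hasDegree⁺ 0 , const-hasDegree⁺ 0
  rs-hasDegree⁺ (suc n) =
    ⊗-hasDegree⁺ (⊗-hasDegree⁺ (⊗-hasDegree⁺ b+1-hasDegree⁺ (const-hasDegree⁺ e)) hr) (^ᵖ-hasDegree⁺ hs e) ,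
    ⊕-hasDegree⁺ (^ᵖ-hasDegree⁺ hr d) (⊗-hasDegree⁺ (const-hasDegree⁺ e′) (^ᵖ-hasDegree⁺ hs d))
    where
    hr : HasDegree⁺ (r d n) (degr n)
    hr = proj₁ (rs-hasDegree⁺ n)
    hs : HasDegree⁺ (s d n) (degs n)
    hs = proj₂ (rs-hasDegree⁺ n)

  s-hasDegree⁺ : ∀ n → HasDegree⁺ (s d n) (degs n)
  s-hasDegree⁺ n = proj₂ (rs-hasDegree⁺ n)

  σ-hasDegree⁺ : ∀ n → HasDegree⁺ (σ d (suc n)) (suc (d * degs n))
  σ-hasDegree⁺ n = ⊗-hasDegree⁺ (⊗-hasDegree⁺ b+1-hasDegree⁺ (const-hasDegree⁺ e)) (^ᵖ-hasDegree⁺ (s-hasDegree⁺ n) d)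

  deg-σ : ∀ n → deg (σ d (suc n)) ≡ suc (d * degs n)
  deg-σ n = deg-hasDegree⁺ (σ-hasDegree⁺ n)

  degs-suc-≤ : ∀ {n} → degr n ≤ degs n → degs (suc n) ≡ d * degs n
  degs-suc-≤ r≤s = ℕP.m≤n⇒m⊔n≡n (ℕP.*-monoʳ-≤ d r≤s)

  degs-suc-> : ∀ {n} → degr n ≡ suc (degs n) → degs (suc n) ≡ d * degr n
  degs-suc-> {n} r≡1+s = ℕP.m≥n⇒m⊔n≡m (ℕP.*-monoʳ-≤ d (ℕP.≤-trans (ℕP.n≤1+n (degs n)) (ℕP.≤-reflexive (sym r≡1+s))))

  deg-τ-≤ : ∀ {n} → degr n ≤ degs n → deg (τ d (suc n)) ≡ suc (d * degs n)
  deg-τ-≤ {n} r≤s = deg-⊖ʳ (s-hasDegree⁺ (suc n)) (σ-hasDegree⁺ n)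
    (ℕP.≤-reflexive (cong suc (degs-suc-≤ r≤s)))

  deg-τ-> : ∀ {n} → degr n ≡ suc (degs n) → deg (τ d (suc n)) ≡ degs (suc n)
  deg-τ-> {n} r≡1+s = deg-⊖ˡ (s-hasDegree⁺ (suc n)) (σ-hasDegree⁺ n) (begin-strict
    suc (d * degs n)  <⟨ ℕP.+-monoˡ-< (d * degs n) {1} {d} (s≤s (s≤s z≤n)) ⟩
    d + d * degs n    ≡⟨ ℕP.*-suc d (degs n) ⟨
    d * suc (degs n)  ≡⟨ cong (d *_) r≡1+s ⟨
    d * degr n        ≡⟨ degs-suc-> r≡1+s ⟨
    degs (suc n)      ∎)
    where open ℕP.≤-Reasoning

  D : ℕ
  D = d ^ d ∸ 1

  1<d^d : 1 < d ^ d
  1<d^d = ℕP.^-monoʳ-< d (s≤s (s≤s z≤n)) {0} {d} (s≤s z≤n)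

  0<D : 0 < D
  0<D = ℕP.m<n⇒0<n∸m 1<d^d

  D+1≡d^d : D + 1 ≡ d ^ d
  D+1≡d^d = ℕP.m∸n+n≡m (ℕP.<⇒≤ 1<d^d)

  -- k is the residue of n - 1 modulo d, taken in {1, …, d}: then
  -- (d^d - 1) deg s(n) = d^(n+d-1) - d^k and deg r(n) - deg s(n) = k - (d - 1).
  record Closed (n k : ℕ) : Set where
    constructor closed
    field
      scaled : D * degs n + d ^ k ≡ d ^ (n + e)
      offset : degr n + e ≡ degs n + k

  closed-zero : Closed 0 e
  closed-zero = closed (cong (_+ d ^ e) (ℕP.*-zeroʳ D)) refl

  degr≤degs : ∀ {n k} → k < d → Closed n k → degr n ≤ degs n
  degr≤degs {n} {k} (s≤s k≤e) (closed _ r+e≡s+k) =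
    ℕP.+-cancelʳ-≤ e (degr n) (degs n) (ℕP.≤-trans (ℕP.≤-reflexive r+e≡s+k) (ℕP.+-monoʳ-≤ (degs n) k≤e))

  degr≡1+degs : ∀ {n} → Closed n d → degr n ≡ suc (degs n)
  degr≡1+degs {n} (closed _ r+e≡s+d) = ℕP.+-cancelʳ-≡ e (degr n) (suc (degs n)) (trans r+e≡s+d (ℕP.+-suc (degs n) e))

  closed-σ : ∀ {n k} → Closed n k → D * (d * degs n) + d ^ suc k ≡ d ^ (n + d)
  closed-σ {n} {k} (closed D*s+d^k≡ _) = begin
    D * (d * degs n) + d * d ^ k ≡⟨ factor D d (degs n) (d ^ k) ⟩
    d * (D * degs n + d ^ k)     ≡⟨ cong (d *_) D*s+d^k≡ ⟩
    d ^ suc (n + e)              ≡⟨ cong (d ^_) (ℕP.+-suc n e) ⟨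
    d ^ (n + d)                  ∎
    where
    open ≡-Reasoning
    factor : ∀ D d s x → D * (d * s) + d * x ≡ d * (D * s + x)
    factor = solve-∀

  closed-τ : ∀ {n} → Closed n d → D * (d * degr n) + d ≡ d ^ (n + d)
  closed-τ {n} cl = begin
    D * (d * degr n) + d          ≡⟨ cong (λ r → D * (d * r) + d) (degr≡1+degs cl) ⟩
    D * (d * suc (degs n)) + d    ≡⟨ regroup D d (degs n) ⟩
    D * (d * degs n) + d * (D + 1) ≡⟨ cong (λ x → D * (d * degs n) + d * x) D+1≡d^d ⟩
    D * (d * degs n) + d ^ suc d  ≡⟨ closed-σ cl ⟩
    d ^ (n + d)                   ∎
    where
    open ≡-Reasoning
    regroup : ∀ D d s → D * (d * suc s) + d ≡ D * (d * s) + d * (D + 1)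
    regroup = solve-∀

  closed-suc : ∀ {n k} → k < d → Closed n k → Closed (suc n) (suc k)
  closed-suc {n} {k} k<d cl@(closed _ r+e≡s+k) = closed scaled′ offset′
    where
    open ≡-Reasoning
    s′≡ : degs (suc n) ≡ d * degs n
    s′≡ = degs-suc-≤ (degr≤degs k<d cl)
    scaled′ : D * degs (suc n) + d ^ suc k ≡ d ^ (suc n + e)
    scaled′ = begin
      D * degs (suc n) + d ^ suc k ≡⟨ cong (λ x → D * x + d ^ suc k) s′≡ ⟩
      D * (d * degs n) + d ^ suc k ≡⟨ closed-σ cl ⟩
      d ^ (n + d)                  ≡⟨ cong (d ^_) (ℕP.+-suc n e) ⟩
      d ^ (suc n + e)              ∎
    regroup : ∀ r s e → suc (r + e * s) + e ≡ suc ((r + e) + e * s)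
    regroup = solve-∀
    collect : ∀ s k e → suc ((s + k) + e * s) ≡ suc e * s + suc k
    collect = solve-∀
    offset′ : degr (suc n) + e ≡ degs (suc n) + suc k
    offset′ = begin
      suc (degr n + e * degs n) + e   ≡⟨ regroup (degr n) (degs n) e ⟩
      suc ((degr n + e) + e * degs n) ≡⟨ cong (λ x → suc (x + e * degs n)) r+e≡s+k ⟩
      suc ((degs n + k) + e * degs n) ≡⟨ collect (degs n) k e ⟩
      d * degs n + suc k              ≡⟨ cong (_+ suc k) s′≡ ⟨
      degs (suc n) + suc k            ∎

  closed-wrap : ∀ {n} → Closed n d → Closed (suc n) 1
  closed-wrap {n} cl = closed scaled′ offset′
    where
    open ≡-Reasoning
    r≡1+s : degr n ≡ suc (degs n)
    r≡1+s = degr≡1+degs cl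
    s′≡ : degs (suc n) ≡ d * degr n
    s′≡ = degs-suc-> r≡1+s
    scaled′ : D * degs (suc n) + d ^ 1 ≡ d ^ (suc n + e)
    scaled′ = begin
      D * degs (suc n) + d * 1 ≡⟨ cong₂ (λ x y → D * x + y) s′≡ (ℕP.*-identityʳ d) ⟩
      D * (d * degr n) + d     ≡⟨ closed-τ cl ⟩
      d ^ (n + d)              ≡⟨ cong (d ^_) (ℕP.+-suc n e) ⟩
      d ^ (suc n + e)          ∎
    collect : ∀ s e → suc (suc s + e * s) + e ≡ suc e * suc s + 1
    collect = solve-∀
    offset′ : degr (suc n) + e ≡ degs (suc n) + 1
    offset′ = begin
      suc (degr n + e * degs n) + e       ≡⟨ cong (λ r → suc (r + e * degs n) + e) r≡1+s ⟩
      suc (suc (degs n) + e * degs n) + e ≡⟨ collect (degs n) e ⟩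
      d * suc (degs n) + 1                ≡⟨ cong (λ r → d * r + 1) r≡1+s ⟨
      d * degr n + 1                      ≡⟨ cong (_+ 1) s′≡ ⟨
      degs (suc n) + 1                    ∎

  phase : ∀ n → ∃[ k ] k ≤ d × Closed n k
  phase zero = e , ℕP.n≤1+n e , closed-zero
  phase (suc n) with phase n
  ... | k , k≤d , cl with ℕP.m≤n⇒m<n∨m≡n k≤d
  ...   | inj₁ k<d  = suc k , k<d , closed-suc k<d cl
  ...   | inj₂ refl = 1 , s≤s z≤n , closed-wrap cl

  closed-at : ∀ i k → k < d → Closed (d * i + suc (suc k)) (suc k)
  closed-at zero    zero    _   = subst (λ n → Closed n 1) (cong (_+ 2) (sym (ℕP.*-zeroʳ d)))
    (closed-wrap (closed-suc (ℕP.n<1+n e) closed-zero))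
  closed-at (suc i) zero    _   = subst (λ n → Closed n 1) (shift d i)
    (closed-wrap (closed-at i e (ℕP.n<1+n e)))
    where
    shift : ∀ d i → suc (d * i + suc d) ≡ d * suc i + 2
    shift = solve-∀
  closed-at i       (suc k) k<d = subst (λ n → Closed n (suc (suc k))) (sym (ℕP.+-suc (d * i) (suc (suc k))))
    (closed-suc k<d (closed-at i k (ℕP.<-trans (ℕP.n<1+n k) k<d)))

  closed-at-top : ∀ i → Closed (d * i + 1) d
  closed-at-top zero    = subst (λ n → Closed n d) (cong (_+ 1) (sym (ℕP.*-zeroʳ d)))
    (closed-suc (ℕP.n<1+n e) closed-zero)
  closed-at-top (suc i) = subst (λ n → Closed n d) (shift d i)
    (closed-suc (ℕP.n<1+n e) (closed-at i e′ (ℕP.<-trans (ℕP.n<1+n e′) (ℕP.n<1+n e))))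
    where
    shift : ∀ d i → suc (d * i + d) ≡ d * suc i + 1
    shift = solve-∀

  deg-σ-closed : ∀ {n k} → Closed n k → deg (σ d (suc n)) ≡ ((d ^ (n + d) ∸ d ^ suc k) divℕ D) + 1
  deg-σ-closed {n} cl = trans (deg-σ n) (trans (ℕP.+-comm 1 _) (cong (_+ 1) (sym (divℕ-exact 0<D (closed-σ cl)))))

  degrees-below : ∀ {n k} → k < d → Closed n k →
      (deg (σ d (suc n)) ≡ ((d ^ (n + d) ∸ d ^ suc k) divℕ D) + 1)
    × (deg (τ d (suc n)) ≡ ((d ^ (n + d) ∸ d ^ suc k) divℕ D) + 1)
  degrees-below {n} k<d cl = deg-σ-closed cl , trans (deg-τ-≤ (degr≤degs k<d cl)) (trans (sym (deg-σ n)) (deg-σ-closed cl))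

  degrees-top : ∀ {n} → Closed n d →
      (deg (σ d (suc n)) ≡ ((d ^ (n + d) ∸ d ^ (d + 1)) divℕ D) + 1)
    × (deg (τ d (suc n)) ≡ (d ^ (n + d) ∸ d) divℕ D)
    × (deg (τ d (suc n)) ≡ deg (s d (suc n)))
  degrees-top {n} cl =
    trans (deg-σ-closed cl) (cong (λ k → (d ^ (n + d) ∸ d ^ k) divℕ D + 1) (ℕP.+-comm 1 d)) ,
    trans τ≡s (trans (degs-suc-> (degr≡1+degs cl)) (sym (divℕ-exact 0<D (closed-τ cl)))) ,
    trans τ≡s (sym (deg-hasDegree⁺ (s-hasDegree⁺ (suc n))))
    where
    τ≡s : deg (τ d (suc n)) ≡ degs (suc n)
    τ≡s = deg-τ-> (degr≡1+degs cl)

  degree-formulas : ∀ (m i j : ℕ) → 2 ≤ m → m ≡ d * i + j → 2 ≤ j → j ≤ d + 1 →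
        (d ∣ (m ∸ 2) →
            (deg (σ d m) ≡ ((d ^ (m + d ∸ 1) ∸ d ^ (d + 1)) divℕ D) + 1)
          × (deg (τ d m) ≡ (d ^ (m + d ∸ 1) ∸ d) divℕ D)
          × (deg (τ d m) ≡ deg (s d m)))
        × (¬ (d ∣ (m ∸ 2)) →
            (deg (σ d m) ≡ ((d ^ (m + d ∸ 1) ∸ d ^ (j ∸ 1)) divℕ D) + 1)
          × (deg (τ d m) ≡ ((d ^ (m + d ∸ 1) ∸ d ^ (j ∸ 1)) divℕ D) + 1))
  degree-formulas m i 1 _ _ (s≤s ()) _
  degree-formulas m i 2 _ m≡ _ _ with trans m≡ (ℕP.+-suc (d * i) 1)
  ... | refl rewrite ℕP.m+n∸n≡m (d * i) 1 =
    (λ _ → degrees-top (closed-at-top i)) , (λ d∤ → ⊥-elim (d∤ (m∣m*n i)))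
  degree-formulas m i (suc (suc (suc k))) _ m≡ _ j≤d+1 with trans m≡ (ℕP.+-suc (d * i) (suc (suc k)))
  ... | refl rewrite ℕP.+-∸-assoc (d * i) {suc (suc k)} {1} (s≤s z≤n) =
    (λ d∣ → ⊥-elim (>⇒∤ 1+k<d (∣m+n∣m⇒∣n d∣ (m∣m*n i)))) , (λ _ → degrees-below 1+k<d (closed-at i k k<d))
    where
    1+k<d : suc k < d
    1+k<d = ℕP.≤-pred (ℕP.≤-trans j≤d+1 (ℕP.≤-reflexive (ℕP.+-comm d 1)))
    k<d : k < d
    k<d = ℕP.<-trans (ℕP.n<1+n k) 1+k<d

  K : ℕ
  K = d ^ suc d + D

  d^[n+d] : ∀ n → d ^ (n + d) ≡ d ^ d * d ^ n
  d^[n+d] n = trans (ℕP.^-distribˡ-+-* d n d) (ℕP.*-comm (d ^ n) (d ^ d))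

  σ-bound : ∀ {n k} → k ≤ d → Closed n k → ∣ suc (d * degs n) * D - d ^ d * d ^ n ∣ ≤ K
  σ-bound {n} {k} k≤d cl = ℕP.≤-trans (∣-∣≤ (suc (d * degs n) * D) (d ^ d * d ^ n) (d ^ suc k) D balance)
    (ℕP.+-monoˡ-≤ D (ℕP.^-monoʳ-≤ d (s≤s k≤d)))
    where
    shift : ∀ D x t → suc x * D + t ≡ (D * x + t) + D
    shift = solve-∀
    balance : suc (d * degs n) * D + d ^ suc k ≡ d ^ d * d ^ n + D
    balance = trans (shift D (d * degs n) (d ^ suc k)) (cong (_+ D) (trans (closed-σ cl) (d^[n+d] n)))

  τ-bound-top : ∀ {n} → Closed n d → ∣ d * degr n * D - d ^ d * d ^ n ∣ ≤ K
  τ-bound-top {n} cl = ℕP.≤-trans (∣-∣≤ (d * degr n * D) (d ^ d * d ^ n) d 0 balance)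
    (ℕP.+-mono-≤ (ℕP.m≤m*n d (d ^ d) {{ℕP.m^n≢0 d d}}) z≤n)
    where
    balance : d * degr n * D + d ≡ d ^ d * d ^ n + 0
    balance = trans (cong (_+ d) (ℕP.*-comm (d * degr n) D))
      (trans (closed-τ cl) (trans (d^[n+d] n) (sym (ℕP.+-identityʳ _))))

  σ-bound-at : ∀ n → ∣ deg (σ d (suc n)) * D - d ^ d * d ^ n ∣ ≤ K
  σ-bound-at n with phase n
  ... | k , k≤d , cl rewrite deg-σ n = σ-bound k≤d cl

  τ-bound-at : ∀ n → ∣ deg (τ d (suc n)) * D - d ^ d * d ^ n ∣ ≤ K
  τ-bound-at n with phase n
  ... | k , k≤d , cl with ℕP.m≤n⇒m<n∨m≡n k≤d
  ...   | inj₁ k<d  rewrite deg-τ-≤ (degr≤degs k<d cl) = σ-bound k≤d cl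
  ...   | inj₂ refl rewrite deg-τ-> (degr≡1+degs cl) | degs-suc-> (degr≡1+degs cl) = τ-bound-top cl

  σ-converges : ConvergesTo (λ m → deg (σ d m) ÷ℕ (d ^ (m ∸ 1))) ((d ^ d) ÷ℕ D)
  σ-converges = ratio-converges _ _ (d ^ d) D K 0<D (^-pred-unbounded (s≤s (s≤s z≤n)))
    (1 , λ { (suc n) _ → σ-bound-at n })

  τ-converges : ConvergesTo (λ m → deg (τ d m) ÷ℕ (d ^ (m ∸ 1))) ((d ^ d) ÷ℕ D)
  τ-converges = ratio-converges _ _ (d ^ d) D K 0<D (^-pred-unbounded (s≤s (s≤s z≤n)))
    (1 , λ { (suc n) _ → τ-bound-at n })

proposition4p1 : ∀ (d : ℕ) → 2 ≤ d →
      (∀ (m i j : ℕ) → 2 ≤ m → m ≡ d * i + j → 2 ≤ j → j ≤ d + 1 →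
        (d ∣ (m ∸ 2) →
            (deg (σ d m) ≡ ((d ^ (m + d ∸ 1) ∸ d ^ (d + 1)) divℕ (d ^ d ∸ 1)) + 1)
          × (deg (τ d m) ≡ (d ^ (m + d ∸ 1) ∸ d) divℕ (d ^ d ∸ 1))
          × (deg (τ d m) ≡ deg (s d m)))
        × (¬ (d ∣ (m ∸ 2)) →
            (deg (σ d m) ≡ ((d ^ (m + d ∸ 1) ∸ d ^ (j ∸ 1)) divℕ (d ^ d ∸ 1)) + 1)
          × (deg (τ d m) ≡ ((d ^ (m + d ∸ 1) ∸ d ^ (j ∸ 1)) divℕ (d ^ d ∸ 1)) + 1)))
    × ConvergesTo (λ m → deg (σ d m) ÷ℕ (d ^ (m ∸ 1))) ((d ^ d) ÷ℕ (d ^ d ∸ 1))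
    × ConvergesTo (λ m → deg (τ d m) ÷ℕ (d ^ (m ∸ 1))) ((d ^ d) ÷ℕ (d ^ d ∸ 1))
proposition4p1 (suc zero)     (s≤s ())
proposition4p1 (suc (suc e′)) _ = degree-formulas , σ-converges , τ-converges
  where open Recurrence e′
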